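{- For $s,n\ge 3$, in the vertex online Ramsey game for $(K_{1,s-1}^*,K_{n-1})$, Builder has a strategy which ensures a red $K_{1,s-1}^*$ or a blue $K_{n-1}$ using at most $n-1+(s-2)(n-2)$ vertices, at most $(s-2)(n-2)+1$ red edges, and at most $(s-1)\binom{n-1}{2}$ edges in total.
   Context: Vertex online Ramsey game for ordered graphs $H_1,H_2$: Builder and Painter start from the empty graph; at step $i$ a new vertex $v_i$ is revealed, and for each existing vertex $v_j$ ($j=1,\dots,i-1$), in order, Builder decides whether to draw the edge $\{v_j,v_i\}$; if drawn, Painter immediately colors it red or blue. Builder wins when the current graph contains a red ordered copy of $H_1$ or a blue ordered copy of $H_2$ (vertices ordered by arrival). The forward star $K_{1,s-1}^*$ is the ordered graph on $s$ vertices whose first vertex is adjacent to each of the other $s-1$ vertices and which has no other edges; $K_{n-1}$ is the complete graph on $n-1$ vertices. -}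

module Defs where

open import Data.Nat using (ℕ; zero; suc; _+_; _≤_; _<_)
open import Data.Fin as Fin using (Fin; toℕ)
open import Data.List using (List; []; _∷_; length)
open import Data.Product using (Σ; _×_; _,_)
open import Data.Sum using (_⊎_)
open import Data.Unit using (⊤)
open import Relation.Binary.PropositionalEquality using (_≡_)
open import Data.List.Membership.Propositional using (_∈_)

data Colour : Set where
  red blue : Colour

-- An ordered graph on h vertices (vertex order = order of Fin h).
-- The relation adj a b is only consulted for a < b (i.e. it lists the edges {a,b}).
record OrdGraph : Set₁ where
  field
    size : ℕ
    adj  : Fin size → Fin size → Set
open OrdGraph public

forwardStar : ℕ → OrdGraph
forwardStar s = record { size = s ; adj = λ a b → toℕ a ≡ 0 }

complete : ℕ → OrdGraph
complete m = record { size = m ; adj = λ a b → ⊤ }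

-- A coloured edge (u , v , c) with u < v (vertices are indices in order of arrival).
ColEdge : Set
ColEdge = ℕ × ℕ × Colour

redCount : List ColEdge → ℕ
redCount [] = 0
redCount ((_ , _ , red) ∷ E) = suc (redCount E)
redCount ((_ , _ , blue) ∷ E) = redCount E

ContainsCopy : ℕ → List ColEdge → Colour → OrdGraph → Set
ContainsCopy N E c H =
  Σ (Fin (size H) → ℕ) λ f →
    ((a b : Fin (size H)) → a Fin.< b → f a < f b) ×
    ((a : Fin (size H)) → f a < N) ×
    ((a b : Fin (size H)) → a Fin.< b → adj H a b → (f a , f b , c) ∈ E)

-- Position (k , j , E):
-- vertices 0..k have been revealed (so suc k vertices), the newest vertex is k,
-- and Builder is now deciding about the edge {j , k} (if j < k); if j = k,
-- all earlier vertices have been handled and a new vertex is revealed next.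
--
-- BuilderWins H₁ H₂ V R M k j E : Builder has a strategy from this position
-- guaranteeing that, against every Painter, the game reaches a red copy of H₁
-- or a blue copy of H₂ at a moment when at most V vertices have been revealed,
-- at most R red edges and at most M edges in total have been drawn.
-- (All three quantities are monotone along a play, so checking them at the
-- winning moment is the same as bounding them over the whole play.)
data BuilderWins (H₁ H₂ : OrdGraph) (V R M : ℕ) : ℕ → ℕ → List ColEdge → Set where
  won    : ∀ {k j E} →
           (ContainsCopy (suc k) E red H₁ ⊎ ContainsCopy (suc k) E blue H₂) →
           suc k ≤ V → redCount E ≤ R → length E ≤ M →
           BuilderWins H₁ H₂ V R M k j E
  reveal : ∀ {k E} →
           BuilderWins H₁ H₂ V R M (suc k) 0 E →
           BuilderWins H₁ H₂ V R M k k E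
  skip   : ∀ {k j E} → j < k →
           BuilderWins H₁ H₂ V R M k (suc j) E →
           BuilderWins H₁ H₂ V R M k j E
  draw   : ∀ {k j E} → j < k →
           ((c : Colour) → BuilderWins H₁ H₂ V R M k (suc j) ((j , k , c) ∷ E)) →
           BuilderWins H₁ H₂ V R M k j E

-- Builder wins the vertex online Ramsey game for (H₁ , H₂) within the budgets:
-- the game starts with the first vertex (vertex 0) revealed and no edges.
BuilderWinsGame : OrdGraph → OrdGraph → (V R M : ℕ) → Set
BuilderWinsGame H₁ H₂ V R M = BuilderWins H₁ H₂ V R M 0 0 []

-- Builder keeps a blue clique of centres v₁ < … < vₘ, each the root of a red
-- forward star.  When a vertex arrives he probes v₁, v₂, … in order: the first
-- red edge makes the vertex a leaf of that star, and if every edge is blue the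
-- vertex becomes a new centre.  A star with s − 1 leaves is a red K*₁,ₛ₋₁, and
-- n − 2 centres plus one more all-blue vertex form a blue Kₙ₋₁.  Before the
-- last move there are at most n − 2 centres with at most s − 2 leaves each,
-- and a leaf of the i-th star costs i edges, which gives the three bounds.
module Submission where

open import Defs
open import Data.Nat using (ℕ; zero; suc; _+_; _*_; _∸_; _≤_; _<_; _≤′_; ≤′-refl; ≤′-step; z≤n; s≤s; _≟_)
open import Data.Nat.Combinatorics using (_C_; nCk+nC[k+1]≡[n+1]C[k+1]; nC1≡n)
open import Data.Nat.Properties
open import Data.Fin as Fin using (Fin; toℕ)
open import Data.Fin.Properties using (toℕ<n)
open import Data.List using (List; []; _∷_; length; map; _++_; _∷ʳ_)
open import Data.List.Properties using (map-++; length-++; length-map)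
open import Data.List.Relation.Unary.All as All using (All; []; _∷_)
import Data.List.Relation.Unary.All.Properties as All
open import Data.List.Relation.Unary.AllPairs as AllPairs using (AllPairs; []; _∷_)
import Data.List.Relation.Unary.AllPairs.Properties as AllPairs
open import Data.List.Membership.Propositional using (_∈_)
open import Data.List.Relation.Binary.Subset.Propositional using (_⊆_)
open import Data.List.Relation.Unary.Any using (here; there)
open import Data.Product using (_,_)
open import Data.Sum using (inj₁; inj₂)
open import Data.Empty using (⊥-elim)
open import Function using (_∘_)
open import Relation.Nullary using (yes; no)
open import Relation.Binary.PropositionalEquality
open import Algebra.Properties.CommutativeSemigroup +-commutativeSemigroup using (x∙yz≈y∙xz)

[n+1]C2≡n+nC2 : ∀ n → suc n C 2 ≡ n + n C 2
[n+1]C2≡n+nC2 n = sym (trans (cong (_+ n C 2) (sym (nC1≡n n))) (nCk+nC[k+1]≡[n+1]C[k+1] n 1))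

C2-mono : ∀ {m n} → m ≤ n → m C 2 ≤ n C 2
C2-mono z≤n = z≤n
C2-mono {suc m} {suc n} (s≤s m≤n) rewrite [n+1]C2≡n+nC2 m | [n+1]C2≡n+nC2 n =
  +-mono-≤ m≤n (C2-mono m≤n)

length-∷ʳ : ∀ {A : Set} (xs : List A) x → length (xs ∷ʳ x) ≡ suc (length xs)
length-∷ʳ xs x = trans (length-++ xs) (+-comm (length xs) 1)

length-update : ∀ {A : Set} (pre : List A) {x y} post →
                length (pre ++ y ∷ post) ≡ length (pre ++ x ∷ post)
length-update pre post = trans (length-++ pre) (sym (length-++ pre))

length-prefix< : ∀ {A : Set} (pre : List A) {x} post → length pre < length (pre ++ x ∷ post)
length-prefix< pre post = subst (length pre <_) (sym (length-++ pre)) (m<m+n (length pre) (s≤s z≤n))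

All-middle : ∀ {A : Set} {P : A → Set} pre {x post} → All P (pre ++ x ∷ post) → P x
All-middle pre ps = All.head (All.++⁻ʳ pre ps)

All-update : ∀ {A : Set} {P : A → Set} pre {x y post} →
             All P (pre ++ x ∷ post) → P y → All P (pre ++ y ∷ post)
All-update pre ps py = All.++⁺ (All.++⁻ˡ pre ps) (py ∷ All.tail (All.++⁻ʳ pre ps))

AllPairs-∷ʳ⁺ : ∀ {A : Set} {R : A → A → Set} {xs y} →
               AllPairs R xs → All (λ x → R x y) xs → AllPairs R (xs ∷ʳ y)
AllPairs-∷ʳ⁺ rs ry = AllPairs.++⁺ rs ([] ∷ []) (All.map (_∷ []) ry)

-- Indexing with a junk value 0 past the end; only used inside the bounds.
nth : List ℕ → ℕ → ℕ
nth []       _       = 0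
nth (x ∷ xs) zero    = x
nth (x ∷ xs) (suc i) = nth xs i

All-nth : ∀ {P : ℕ → Set} {xs i} → All P xs → i < length xs → P (nth xs i)
All-nth {i = zero}  (px ∷ _)  _         = px
All-nth {i = suc i} (_ ∷ pxs) (s≤s i<n) = All-nth pxs i<n

AllPairs-nth : ∀ {R : ℕ → ℕ → Set} {xs i j} →
               AllPairs R xs → i < j → j < length xs → R (nth xs i) (nth xs j)
AllPairs-nth {i = zero}  {suc j} (rx ∷ _)  _         (s≤s j<n) = All-nth rx j<n
AllPairs-nth {i = suc i} {suc j} (_ ∷ rxs) (s≤s i<j) (s≤s j<n) = AllPairs-nth rxs i<j j<n

list-copy : ∀ {N E c} (xs : List ℕ) (A : Fin (length xs) → Fin (length xs) → Set) →
            AllPairs _<_ xs → All (_< N) xs →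
            (∀ a b → a Fin.< b → A a b → (nth xs (toℕ a) , nth xs (toℕ b) , c) ∈ E) →
            ContainsCopy N E c (record { size = length xs ; adj = A })
list-copy xs A increasing bounded edges =
    (λ a → nth xs (toℕ a))
  , (λ a b a<b → AllPairs-nth increasing a<b (toℕ<n b))
  , (λ a → All-nth bounded (toℕ<n a))
  , edges

BlueEdge : List ColEdge → ℕ → ℕ → Set
BlueEdge E x y = (x , y , blue) ∈ E

clique-copy : ∀ {N E} xs → AllPairs _<_ xs → All (_< N) xs → AllPairs (BlueEdge E) xs →
              ContainsCopy N E blue (complete (length xs))
clique-copy xs increasing bounded blues =
  list-copy xs _ increasing bounded (λ a b a<b _ → AllPairs-nth blues a<b (toℕ<n b))

star-copy : ∀ {N E} v ts → AllPairs _<_ (v ∷ ts) → All (_< N) (v ∷ ts) →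
            All (λ t → (v , t , red) ∈ E) ts → ContainsCopy N E red (forwardStar (suc (length ts)))
star-copy {E = E} v ts increasing bounded reds = list-copy (v ∷ ts) _ increasing bounded edges
  where
    edges : ∀ a b → a Fin.< b → toℕ a ≡ 0 →
            (nth (v ∷ ts) (toℕ a) , nth (v ∷ ts) (toℕ b) , red) ∈ E
    edges Fin.zero    (Fin.suc b) _ _  = All-nth reds (toℕ<n b)
    edges (Fin.suc a) _           _ ()

blueFan : ℕ → List ℕ → List ColEdge → List ColEdge
blueFan w []       E = E
blueFan w (x ∷ xs) E = blueFan w xs ((x , w , blue) ∷ E)

length-blueFan : ∀ w xs E → length (blueFan w xs E) ≡ length xs + length E
length-blueFan w []       E = refl
length-blueFan w (x ∷ xs) E = trans (length-blueFan w xs _) (+-suc (length xs) (length E))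

length-blueFan-map : ∀ {A : Set} w (f : A → ℕ) xs E →
                     length (blueFan w (map f xs) E) ≡ length xs + length E
length-blueFan-map w f xs E = trans (length-blueFan w (map f xs) E) (cong (_+ length E) (length-map f xs))

redCount-blueFan : ∀ w xs E → redCount (blueFan w xs E) ≡ redCount E
redCount-blueFan w []       E = refl
redCount-blueFan w (x ∷ xs) E = redCount-blueFan w xs _

blueFan-⊇ : ∀ w xs {E} → E ⊆ blueFan w xs E
blueFan-⊇ w []       e∈E = e∈E
blueFan-⊇ w (x ∷ xs) e∈E = blueFan-⊇ w xs (there e∈E)

blueFan-blue : ∀ w xs {E} → All (λ x → BlueEdge (blueFan w xs E) x w) xs
blueFan-blue w []       = []
blueFan-blue w (x ∷ xs) = blueFan-⊇ w xs (here refl) ∷ blueFan-blue w xs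

module Moves {H₁ H₂ : OrdGraph} {V R M : ℕ} where

  private
    BW = BuilderWins H₁ H₂ V R M

  skipTo′ : ∀ {k j t E} → j ≤′ t → t ≤ k → BW k t E → BW k j E
  skipTo′ ≤′-refl       _   w = w
  skipTo′ (≤′-step j≤t) t≤k w = skipTo′ j≤t (<⇒≤ t≤k) (skip t≤k w)

  skipTo : ∀ {k j t E} → j ≤ t → t ≤ k → BW k t E → BW k j E
  skipTo j≤t = skipTo′ (≤⇒≤′ j≤t)

  probe : ∀ {A : Set} (key : A → ℕ) {k j E} (xs : List A) →
          AllPairs _<_ (map key xs) → All (j ≤_) (map key xs) → All (_≤ k) (map key xs) →
          j ≤ suc k →
          BW (suc k) (suc k) (blueFan (suc k) (map key xs) E) →
          (∀ pre x post → xs ≡ pre ++ x ∷ post →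
             BW (suc k) (suc k) ((key x , suc k , red) ∷ blueFan (suc k) (map key pre) E)) →
          BW (suc k) j E
  probe key []       _                _          _          j≤k allBlue _ =
    skipTo j≤k ≤-refl allBlue
  probe key (x ∷ xs) (x<xs ∷ sorted) (j≤x ∷ _) (x≤k ∷ xs≤k) _   allBlue firstRed =
    skipTo j≤x (m≤n⇒m≤1+n x≤k) (draw (s≤s x≤k) λ
      { red  → skipTo (s≤s x≤k) ≤-refl (firstRed [] x xs refl)
      ; blue → probe key xs sorted x<xs xs≤k (s≤s x≤k) allBlue
                 (λ pre y post eq → firstRed (x ∷ pre) y post (cong (x ∷_) eq)) })

record Star : Set where
  constructor star
  field
    centre : ℕ
    leaves : List ℕ
open Star

addLeaf : ℕ → Star → Star
addLeaf t x = record x { leaves = leaves x ∷ʳ t }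

record IsRedStar (k : ℕ) (E : List ColEdge) (x : Star) : Set where
  field
    increasing : AllPairs _<_ (centre x ∷ leaves x)
    revealed   : All (_≤ k) (centre x ∷ leaves x)
    red-leaves : All (λ t → (centre x , t , red) ∈ E) (leaves x)

record IsConfig (k : ℕ) (E : List ColEdge) (ms : List Star) : Set where
  field
    centres-increasing : AllPairs _<_ (map centre ms)
    centres-blue       : AllPairs (BlueEdge E) (map centre ms)
    red-stars          : All (IsRedStar k E) ms

centres-revealed : ∀ {k E ms} → IsConfig k E ms → All (_≤ k) (map centre ms)
centres-revealed c = All.map⁺ (All.map (All.head ∘ IsRedStar.revealed) (IsConfig.red-stars c))

IsRedStar-weaken : ∀ {k k′ E E′ x} → k ≤ k′ → E ⊆ E′ → IsRedStar k E x → IsRedStar k′ E′ x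
IsRedStar-weaken k≤k′ E⊆E′ s = record
  { increasing = IsRedStar.increasing s
  ; revealed   = All.map (λ t≤k → ≤-trans t≤k k≤k′) (IsRedStar.revealed s)
  ; red-leaves = All.map E⊆E′ (IsRedStar.red-leaves s)
  }

IsRedStar-addLeaf : ∀ {k E E′ x} → IsRedStar k E x → E ⊆ E′ → (centre x , suc k , red) ∈ E′ →
                    IsRedStar (suc k) E′ (addLeaf (suc k) x)
IsRedStar-addLeaf s E⊆E′ new = record
  { increasing = AllPairs-∷ʳ⁺ (IsRedStar.increasing s) (All.map s≤s (IsRedStar.revealed s))
  ; revealed   = All.∷ʳ⁺ (All.map m≤n⇒m≤1+n (IsRedStar.revealed s)) ≤-refl
  ; red-leaves = All.∷ʳ⁺ (All.map E⊆E′ (IsRedStar.red-leaves s)) new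
  }

IsConfig-newCentre : ∀ {k E ms} → IsConfig k E ms →
                     IsConfig (suc k) (blueFan (suc k) (map centre ms) E) (ms ∷ʳ star (suc k) [])
IsConfig-newCentre {k} {E} {ms} c = record
  { centres-increasing = subst (AllPairs _<_) (sym centres)
      (AllPairs-∷ʳ⁺ (IsConfig.centres-increasing c) (All.map s≤s (centres-revealed c)))
  ; centres-blue = subst (AllPairs (BlueEdge _)) (sym centres)
      (AllPairs-∷ʳ⁺ (AllPairs.map E⊆E′ (IsConfig.centres-blue c)) (blueFan-blue (suc k) (map centre ms)))
  ; red-stars = All.∷ʳ⁺ (All.map (IsRedStar-weaken (n≤1+n k) E⊆E′) (IsConfig.red-stars c))
      (record { increasing = [] ∷ [] ; revealed = ≤-refl ∷ [] ; red-leaves = [] })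
  }
  where
    E⊆E′ : E ⊆ blueFan (suc k) (map centre ms) E
    E⊆E′ = blueFan-⊇ (suc k) (map centre ms)
    centres : map centre (ms ∷ʳ star (suc k) []) ≡ map centre ms ∷ʳ suc k
    centres = map-++ centre ms _

IsConfig-addLeaf : ∀ {k E E′} pre x post → IsConfig k E (pre ++ x ∷ post) → E ⊆ E′ →
                   (centre x , suc k , red) ∈ E′ →
                   IsConfig (suc k) E′ (pre ++ addLeaf (suc k) x ∷ post)
IsConfig-addLeaf {k} pre x post c E⊆E′ new = record
  { centres-increasing = subst (AllPairs _<_) centres (IsConfig.centres-increasing c)
  ; centres-blue = subst (AllPairs (BlueEdge _)) centres
      (AllPairs.map E⊆E′ (IsConfig.centres-blue c))
  ; red-stars = All-update pre (All.map (IsRedStar-weaken (n≤1+n k) E⊆E′) stars)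
      (IsRedStar-addLeaf (All-middle pre stars) E⊆E′ new)
  }
  where
    stars = IsConfig.red-stars c
    centres : map centre (pre ++ x ∷ post) ≡ map centre (pre ++ addLeaf (suc k) x ∷ post)
    centres = trans (map-++ centre pre _) (sym (map-++ centre pre _))

leafCount : List Star → ℕ
leafCount []       = 0
leafCount (x ∷ ms) = length (leaves x) + leafCount ms

-- A leaf of the i-th star (counting from 1) costs i edges: i − 1 blue ones and
-- the red one; the i-th star's leaves are counted in the first i summands.
leafEdges : List Star → ℕ
leafEdges []       = 0
leafEdges (x ∷ ms) = leafCount (x ∷ ms) + leafEdges ms

leafCount-newCentre : ∀ ms v → leafCount (ms ∷ʳ star v []) ≡ leafCount ms
leafCount-newCentre []       v = refl
leafCount-newCentre (x ∷ ms) v = cong (length (leaves x) +_) (leafCount-newCentre ms v)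

leafEdges-newCentre : ∀ ms v → leafEdges (ms ∷ʳ star v []) ≡ leafEdges ms
leafEdges-newCentre []       v = refl
leafEdges-newCentre (x ∷ ms) v =
  cong₂ _+_ (leafCount-newCentre (x ∷ ms) v) (leafEdges-newCentre ms v)

leafCount-addLeaf : ∀ pre x post t →
                    leafCount (pre ++ addLeaf t x ∷ post) ≡ suc (leafCount (pre ++ x ∷ post))
leafCount-addLeaf []      x post t = cong (_+ leafCount post) (length-∷ʳ (leaves x) t)
leafCount-addLeaf (y ∷ pre) x post t =
  trans (cong (length (leaves y) +_) (leafCount-addLeaf pre x post t)) (+-suc (length (leaves y)) _)

leafEdges-addLeaf : ∀ pre x post t →
                    leafEdges (pre ++ addLeaf t x ∷ post) ≡ suc (length pre) + leafEdges (pre ++ x ∷ post)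
leafEdges-addLeaf []        x post t = cong (_+ leafEdges post) (leafCount-addLeaf [] x post t)
leafEdges-addLeaf (y ∷ pre) x post t = begin
  leafCount (y ∷ pre ++ addLeaf t x ∷ post) + leafEdges (pre ++ addLeaf t x ∷ post)
    ≡⟨ cong₂ _+_ (leafCount-addLeaf (y ∷ pre) x post t) (leafEdges-addLeaf pre x post t) ⟩
  suc (leafCount (y ∷ pre ++ x ∷ post)) + (suc (length pre) + leafEdges (pre ++ x ∷ post))
    ≡⟨ cong suc (x∙yz≈y∙xz (leafCount (y ∷ pre ++ x ∷ post)) (suc (length pre)) _) ⟩
  suc (suc (length pre)) + leafEdges (y ∷ pre ++ x ∷ post) ∎
  where open ≡-Reasoning

leafCount-≤ : ∀ {b} ms → All (λ x → length (leaves x) ≤ b) ms → leafCount ms ≤ b * length ms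
leafCount-≤ {b} []       []       = z≤n
leafCount-≤ {b} (x ∷ ms) (x≤b ∷ ms≤b) =
  subst (leafCount (x ∷ ms) ≤_) (sym (*-suc b (length ms))) (+-mono-≤ x≤b (leafCount-≤ ms ms≤b))

leafEdges-≤ : ∀ {b} ms → All (λ x → length (leaves x) ≤ b) ms →
              leafEdges ms ≤ b * (suc (length ms) C 2)
leafEdges-≤ {b} []       []  = z≤n
leafEdges-≤ {b} (x ∷ ms) ms≤b@(_ ∷ tail≤b) = begin
  leafCount (x ∷ ms) + leafEdges ms
    ≤⟨ +-mono-≤ (leafCount-≤ (x ∷ ms) ms≤b) (leafEdges-≤ ms tail≤b) ⟩
  b * suc (length ms) + b * (suc (length ms) C 2)
    ≡⟨ sym (*-distribˡ-+ b (suc (length ms)) _) ⟩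
  b * (suc (length ms) + suc (length ms) C 2)
    ≡⟨ cong (b *_) (sym ([n+1]C2≡n+nC2 (suc (length ms)))) ⟩
  b * (suc (suc (length ms)) C 2) ∎
  where open ≤-Reasoning

record Counted (k : ℕ) (E : List ColEdge) (ms : List Star) : Set where
  field
    vertex-count : suc k ≡ length ms + leafCount ms
    red-count    : redCount E ≡ leafCount ms
    edge-count   : length E ≡ length ms C 2 + leafEdges ms

fan-edge-count : ∀ {k E ms} → Counted k E ms →
                 length ms + length E ≡ suc (length ms) C 2 + leafEdges ms
fan-edge-count {E = E} {ms} t = begin
  length ms + length E                    ≡⟨ cong (length ms +_) (Counted.edge-count t) ⟩
  length ms + (length ms C 2 + leafEdges ms) ≡⟨ sym (+-assoc (length ms) _ _) ⟩
  (length ms + length ms C 2) + leafEdges ms ≡⟨ cong (_+ leafEdges ms) (sym ([n+1]C2≡n+nC2 (length ms))) ⟩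
  suc (length ms) C 2 + leafEdges ms      ∎
  where open ≡-Reasoning

Counted-newCentre : ∀ {k E ms} → Counted k E ms →
                    Counted (suc k) (blueFan (suc k) (map centre ms) E) (ms ∷ʳ star (suc k) [])
Counted-newCentre {k} {E} {ms} t = record
  { vertex-count = trans (cong suc (Counted.vertex-count t))
      (sym (cong₂ _+_ (length-∷ʳ ms _) (leafCount-newCentre ms _)))
  ; red-count = trans (redCount-blueFan (suc k) (map centre ms) E)
      (trans (Counted.red-count t) (sym (leafCount-newCentre ms (suc k))))
  ; edge-count = begin
      length (blueFan (suc k) (map centre ms) E) ≡⟨ length-blueFan-map (suc k) centre ms E ⟩
      length ms + length E                       ≡⟨ fan-edge-count t ⟩
      suc (length ms) C 2 + leafEdges ms
        ≡⟨ sym (cong₂ (λ m w → m C 2 + w) (length-∷ʳ ms _) (leafEdges-newCentre ms _)) ⟩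
      length ms′ C 2 + leafEdges ms′ ∎
  }
  where
    open ≡-Reasoning
    ms′ = ms ∷ʳ star (suc k) []

Counted-addLeaf : ∀ {k E} pre x post → Counted k E (pre ++ x ∷ post) →
                  Counted (suc k) ((centre x , suc k , red) ∷ blueFan (suc k) (map centre pre) E)
                          (pre ++ addLeaf (suc k) x ∷ post)
Counted-addLeaf {k} {E} pre x post t = record
  { vertex-count = begin
      suc (suc k)                 ≡⟨ cong suc (Counted.vertex-count t) ⟩
      suc (length ms + leafCount ms) ≡⟨ sym (+-suc (length ms) _) ⟩
      length ms + suc (leafCount ms)
        ≡⟨ sym (cong₂ _+_ (length-update pre post) (leafCount-addLeaf pre x post (suc k))) ⟩
      length ms′ + leafCount ms′ ∎
  ; red-count = trans (cong suc (trans (redCount-blueFan (suc k) (map centre pre) E) (Counted.red-count t)))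
      (sym (leafCount-addLeaf pre x post (suc k)))
  ; edge-count = begin
      suc (length (blueFan (suc k) (map centre pre) E))
        ≡⟨ cong suc (length-blueFan-map (suc k) centre pre E) ⟩
      suc (length pre + length E)
        ≡⟨ cong (λ e → suc (length pre + e)) (Counted.edge-count t) ⟩
      suc (length pre) + (length ms C 2 + leafEdges ms)
        ≡⟨ x∙yz≈y∙xz (suc (length pre)) (length ms C 2) _ ⟩
      length ms C 2 + (suc (length pre) + leafEdges ms)
        ≡⟨ sym (cong₂ (λ m w → m C 2 + w) (length-update pre post)
                                          (leafEdges-addLeaf pre x post (suc k))) ⟩
      length ms′ C 2 + leafEdges ms′ ∎
  }
  where
    open ≡-Reasoning
    ms  = pre ++ x ∷ post
    ms′ = pre ++ addLeaf (suc k) x ∷ post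

IsConfig-clique : ∀ {k E ms} → IsConfig k E ms → ContainsCopy (suc k) E blue (complete (length ms))
IsConfig-clique {k} {E} {ms} c =
  subst (ContainsCopy (suc k) E blue ∘ complete) (length-map centre ms)
    (clique-copy (map centre ms) (IsConfig.centres-increasing c)
       (All.map s≤s (centres-revealed c)) (IsConfig.centres-blue c))

IsRedStar-star : ∀ {k E x} → IsRedStar k E x →
                 ContainsCopy (suc k) E red (forwardStar (suc (length (leaves x))))
IsRedStar-star {x = x} s =
  star-copy (centre x) (leaves x) (IsRedStar.increasing s)
    (All.map s≤s (IsRedStar.revealed s)) (IsRedStar.red-leaves s)

-- S = s − 2 and P = n − 2.
module Strategy (S P : ℕ) where

  V R M : ℕ
  V = suc P + S * P
  R = S * P + 1
  M = suc S * (suc P C 2)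

  private
    BW = BuilderWins (forwardStar (suc (suc S))) (complete (suc P)) V R M

  record Bounded (ms : List Star) : Set where
    field
      few-centres : length ms ≤ P
      few-leaves  : All (λ x → length (leaves x) ≤ S) ms

  Bounded-newCentre : ∀ {ms v} → Bounded ms → length ms ≢ P → Bounded (ms ∷ʳ star v [])
  Bounded-newCentre {ms} b m≢P = record
    { few-centres = subst (_≤ P) (sym (length-∷ʳ ms _)) (≤∧≢⇒< (Bounded.few-centres b) m≢P)
    ; few-leaves  = All.∷ʳ⁺ (Bounded.few-leaves b) z≤n
    }

  Bounded-addLeaf : ∀ pre x post {t} → Bounded (pre ++ x ∷ post) → length (leaves x) ≢ S →
                    Bounded (pre ++ addLeaf t x ∷ post)
  Bounded-addLeaf pre x post {t} b l≢S = record
    { few-centres = subst (_≤ P) (sym (length-update pre post)) (Bounded.few-centres b)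
    ; few-leaves  = All-update pre (Bounded.few-leaves b)
        (subst (_≤ S) (sym (length-∷ʳ (leaves x) t))
           (≤∧≢⇒< (All-middle pre (Bounded.few-leaves b)) l≢S))
    }

  record Invariant (k : ℕ) (E : List ColEdge) (ms : List Star) : Set where
    field
      config  : IsConfig k E ms
      counted : Counted k E ms
      bounded : Bounded ms
  open Invariant

  leafCount-≤SP : ∀ {ms} → Bounded ms → leafCount ms ≤ S * P
  leafCount-≤SP {ms} b =
    ≤-trans (leafCount-≤ ms (Bounded.few-leaves b)) (*-monoʳ-≤ S (Bounded.few-centres b))

  vertices-within : ∀ {k E ms} → Invariant k E ms → suc (suc k) ≤ V
  vertices-within {k} {ms = ms} inv = begin
    suc (suc k)                    ≡⟨ cong suc (Counted.vertex-count (counted inv)) ⟩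
    suc (length ms + leafCount ms) ≤⟨ s≤s (+-mono-≤ (Bounded.few-centres (bounded inv))
                                                    (leafCount-≤SP (bounded inv))) ⟩
    V                              ∎
    where open ≤-Reasoning

  reds-within : ∀ {k E ms} → Invariant k E ms → suc (redCount E) ≤ R
  reds-within {E = E} {ms} inv = begin
    suc (redCount E)    ≡⟨ cong suc (Counted.red-count (counted inv)) ⟩
    suc (leafCount ms)  ≤⟨ s≤s (leafCount-≤SP (bounded inv)) ⟩
    suc (S * P)         ≡⟨ +-comm 1 (S * P) ⟩
    R                   ∎
    where open ≤-Reasoning

  edges-within : ∀ {k E ms} → Invariant k E ms → length ms + length E ≤ M
  edges-within {E = E} {ms} inv = begin
    length ms + length E               ≡⟨ fan-edge-count (counted inv) ⟩
    suc (length ms) C 2 + leafEdges ms ≤⟨ +-monoʳ-≤ (suc (length ms) C 2) (leafEdges-≤ ms few-leaves) ⟩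
    suc S * (suc (length ms) C 2)      ≤⟨ *-monoʳ-≤ (suc S) (C2-mono (s≤s few-centres)) ⟩
    M                                  ∎
    where
      open ≤-Reasoning
      open Bounded (bounded inv)

  open Moves

  -- The fuel makes the recursion structural; vertices-within shows it never runs out.
  play : ∀ fuel {k E ms} → V ≤ suc k + fuel → Invariant k E ms → BW k k E

  newCentre : ∀ fuel {k E ms} → V ≤ suc (suc k) + fuel → Invariant k E ms →
              BW (suc k) (suc k) (blueFan (suc k) (map centre ms) E)

  newLeaf : ∀ fuel {k E} pre x post → V ≤ suc (suc k) + fuel → Invariant k E (pre ++ x ∷ post) →
            BW (suc k) (suc k) ((centre x , suc k , red) ∷ blueFan (suc k) (map centre pre) E)

  play zero {k} h inv =
    ⊥-elim (1+n≰n (≤-trans (vertices-within inv) (subst (V ≤_) (+-identityʳ (suc k)) h)))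
  play (suc fuel) {k} {E} {ms} h inv =
    reveal (probe centre ms (IsConfig.centres-increasing (config inv)) (All.universal (λ _ → z≤n) _)
              (centres-revealed (config inv)) z≤n (newCentre fuel h′ inv)
              (λ pre x post ms≡ → newLeaf fuel pre x post h′ (subst (Invariant k E) ms≡ inv)))
    where
      h′ : V ≤ suc (suc k) + fuel
      h′ = subst (V ≤_) (+-suc (suc k) fuel) h

  newCentre fuel {k} {E} {ms} h inv with length ms ≟ P
  ... | yes m≡P =
    won (inj₂ (subst (ContainsCopy (suc (suc k)) E′ blue ∘ complete)
                     (trans (length-∷ʳ ms _) (cong suc m≡P))
                     (IsConfig-clique (IsConfig-newCentre (config inv)))))
        (vertices-within inv)
        (subst (_≤ R) (sym (redCount-blueFan (suc k) (map centre ms) E))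
           (≤-trans (n≤1+n _) (reds-within inv)))
        (subst (_≤ M) (sym (length-blueFan-map (suc k) centre ms E)) (edges-within inv))
    where
      E′ = blueFan (suc k) (map centre ms) E
  ... | no m≢P = play fuel h record
    { config  = IsConfig-newCentre (config inv)
    ; counted = Counted-newCentre (counted inv)
    ; bounded = Bounded-newCentre (bounded inv) m≢P
    }

  newLeaf fuel {k} {E} pre x post h inv with length (leaves x) ≟ S
  ... | yes l≡S =
    won (inj₁ (subst (ContainsCopy (suc (suc k)) E″ red ∘ forwardStar ∘ suc)
                     (trans (length-∷ʳ (leaves x) (suc k)) (cong suc l≡S))
                     (IsRedStar-star (IsRedStar-addLeaf x-red E⊆E″ (here refl)))))
        (vertices-within inv)
        (subst (_≤ R) (sym (cong suc (redCount-blueFan (suc k) (map centre pre) E))) (reds-within inv))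
        (≤-trans (≤-reflexive (cong suc (length-blueFan-map (suc k) centre pre E)))
           (≤-trans (+-monoˡ-≤ (length E) (length-prefix< pre post)) (edges-within inv)))
    where
      E″ = (centre x , suc k , red) ∷ blueFan (suc k) (map centre pre) E
      E⊆E″ : E ⊆ E″
      E⊆E″ = there ∘ blueFan-⊇ (suc k) (map centre pre)
      x-red : IsRedStar k E x
      x-red = All-middle pre (IsConfig.red-stars (config inv))
  ... | no l≢S = play fuel h record
    { config  = IsConfig-addLeaf pre x post (config inv)
                  (there ∘ blueFan-⊇ (suc k) (map centre pre)) (here refl)
    ; counted = Counted-addLeaf pre x post (counted inv)
    ; bounded = Bounded-addLeaf pre x post (bounded inv) l≢S
    }

  builderWins : 1 ≤ P → BuilderWinsGame (forwardStar (suc (suc S))) (complete (suc P)) V R M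
  builderWins 1≤P = play V (n≤1+n V) record
    { config  = record
      { centres-increasing = [] ∷ []
      ; centres-blue       = [] ∷ []
      ; red-stars          =
          record { increasing = [] ∷ [] ; revealed = z≤n ∷ [] ; red-leaves = [] } ∷ []
      }
    ; counted = record { vertex-count = refl ; red-count = refl ; edge-count = refl }
    ; bounded = record { few-centres = 1≤P ; few-leaves = z≤n ∷ [] }
    }

lemma5p2 : (s n : ℕ) → 3 ≤ s → 3 ≤ n →
    BuilderWinsGame (forwardStar s) (complete (n ∸ 1))
      (n ∸ 1 + (s ∸ 2) * (n ∸ 2))
      ((s ∸ 2) * (n ∸ 2) + 1)
      ((s ∸ 1) * ((n ∸ 1) C 2))
lemma5p2 (suc (suc (suc s))) (suc (suc (suc n))) (s≤s (s≤s (s≤s _))) (s≤s (s≤s (s≤s _))) =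
  Strategy.builderWins (suc s) (suc n) (s≤s z≤n)
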